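{- Let $m,n$ be positive integers and define $$S_4:=\sum_{a=1}^{m-2}\sum_{b=1}^{n-2}\binom{m+n+a-b-1}{m+a+1}\binom{m+n-a+b-1}{n+b+1},$$ where an empty sum equals $0$. Then $$S_4=\binom{m+n}{m}^2+\binom{m+n}{m-1}\binom{m+n}{n-1}+\frac{mn}{2(m+n)}\binom{m+n}{m}^2-\binom{2m+2n}{2n}.$$
   Context: $\binom{N}{k}$ denotes the usual binomial coefficient, equal to $0$ when $k<0$ or $k>N$ for integers $N\ge 0$. -}

module Defs where

open import Data.Nat using (ℕ; zero; suc; _+_; _*_; _∸_)
open import Data.Nat.Combinatorics using (_C_)

sumFrom1 : ℕ → (ℕ → ℕ) → ℕ
sumFrom1 zero    f = 0
sumFrom1 (suc k) f = sumFrom1 k f + f (suc k)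

-- S₄ = Σ_{a=1}^{m-2} Σ_{b=1}^{n-2} C(m+n+a-b-1, m+a+1) C(m+n-a+b-1, n+b+1)
-- For 1 ≤ a ≤ m-2, 1 ≤ b ≤ n-2 all top arguments are ≥ 0, so truncated
-- subtraction in ℕ agrees with integer subtraction here.
S4 : ℕ → ℕ → ℕ
S4 m n = sumFrom1 (m ∸ 2) λ a → sumFrom1 (n ∸ 2) λ b →
  ((m + n + a ∸ b ∸ 1) C (m + a + 1)) * ((m + n + b ∸ a ∸ 1) C (n + b + 1))

open import Data.Nat using (NonZero)

2[m+n]≢0 : ∀ m n → .{{NonZero m}} → NonZero (2 * (m + n))
2[m+n]≢0 (suc m) n = _

{-# OPTIONS --safe #-}
-- Write N = m + n and P k = C(N, m + k) C(N, n + k). The core of the proof is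
-- S₄ = Σ_{k ≥ 3} (k − 2) P k. To see it, S₄ is generalised to a four-parameter
-- double sum of products of binomials; as a function of two of the parameters
-- (w, h), both it and the corresponding weighted single sum satisfy the Pascal
-- recurrence F (w+1) (h+1) = F (w+1) h + F w (h+1) and agree on the boundary
-- (by the hockey-stick identity for w = 0 and by upper and ordinary Vandermonde
-- for h = 0). The weighted sum is then classical: Vandermonde gives
-- C(2N, 2m) = P 0 + 2 Σ_{k ≥ 1} P k, and with Q j = C(N−1, m+j) C(N−1, n+j) the
-- terms 2k P k = N (Q (k−1) − Q k) telescope to 2 Σ_{k ≥ 1} k P k = N Q 0, which
-- is (mn/N) C(N, m)². This yields 2N times the identity in ℕ; dividing by 2N in ℚ
-- finishes.
module Submission where

open import Defs

module Combinatorial where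

  open import Data.Nat using (ℕ; zero; suc; _+_; _*_; _∸_; _≤_; _<_; z≤n; s≤s; z<s; s<s; _≤?_)
  open import Data.Nat.Properties
  open import Data.Nat.Combinatorics
    using (_C_; nCk≡nC[n∸k]; nCn≡1; nC1≡n; k>n⇒nCk≡0; nCk+nC[k+1]≡[n+1]C[k+1])
  open import Data.Nat.Solver using (module +-*-Solver)
  open import Relation.Binary.PropositionalEquality
  open import Relation.Nullary using (yes; no)
  open import Data.Product using (_×_; _,_)
  import Algebra.Properties.CommutativeSemigroup
  open Algebra.Properties.CommutativeSemigroup +-commutativeSemigroup
    using (interchange; x∙yz≈y∙xz; x∙yz≈y∙zx; xy∙z≈xz∙y)
  module *-CS = Algebra.Properties.CommutativeSemigroup *-commutativeSemigroup
  open +-*-Solver using (solve; _:=_; con; _:+_; _:*_)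
  open ≡-Reasoning

  -- Pascal's rule holds definitionally for this binomial, unlike for the library's _C_.
  infix 8 _choose_
  _choose_ : ℕ → ℕ → ℕ
  n     choose zero  = 1
  zero  choose suc k = 0
  suc n choose suc k = n choose k + n choose suc k

  choose≡C : ∀ n k → n choose k ≡ n C k
  choose≡C n       zero    = sym (trans (nCk≡nC[n∸k] {0} {n} z≤n) (nCn≡1 n))
  choose≡C zero    (suc k) = refl
  choose≡C (suc n) (suc k) =
    trans (cong₂ _+_ (choose≡C n k) (choose≡C n (suc k))) (nCk+nC[k+1]≡[n+1]C[k+1] n k)

  C≡choose : ∀ {n k n′ k′} → n ≡ n′ → k ≡ k′ → n C k ≡ n′ choose k′
  C≡choose {n} {k} refl refl = sym (choose≡C n k)

  n<k⇒choose≡0 : ∀ {n k} → n < k → n choose k ≡ 0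
  n<k⇒choose≡0 {n} {k} n<k = trans (choose≡C n k) (k>n⇒nCk≡0 n<k)

  choose-diag : ∀ n → n choose n ≡ 1
  choose-diag n = trans (choose≡C n n) (nCn≡1 n)

  choose-complement : ∀ {n} a b → a + b ≡ n → n choose a ≡ n choose b
  choose-complement {n} a b refl = begin
    (a + b) choose a        ≡⟨ choose≡C (a + b) a ⟩
    (a + b) C a             ≡⟨ nCk≡nC[n∸k] (m≤m+n a b) ⟩
    (a + b) C (a + b ∸ a)   ≡⟨ cong ((a + b) C_) (m+n∸m≡n a b) ⟩
    (a + b) C b             ≡⟨ choose≡C (a + b) b ⟨
    (a + b) choose b        ∎

  choose-pascal : ∀ p q → (suc p + suc q) choose suc q ≡ (suc p + q) choose q + (p + suc q) choose suc q
  choose-pascal p q = cong (λ n → n choose q + (p + suc q) choose suc q) (+-suc p q)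

  choose-absorption : ∀ n k → suc k * suc n choose suc k ≡ suc n * n choose k
  choose-absorption zero    zero    = refl
  choose-absorption zero    (suc k) = *-zeroʳ (suc (suc k))
  choose-absorption (suc n) zero    = begin
    1 * suc (suc n) choose 1  ≡⟨ *-identityˡ _ ⟩
    suc (suc n) choose 1      ≡⟨ trans (choose≡C (suc (suc n)) 1) (nC1≡n (suc (suc n))) ⟩
    suc (suc n)               ≡⟨ *-identityʳ _ ⟨
    suc (suc n) * 1           ∎
  choose-absorption (suc n) (suc k) = begin
    suc (suc k) * ((a + b) + (b + c))
      ≡⟨ solve 5 (λ K a b b′ c → (con 2 :+ K) :* (a :+ b :+ (b′ :+ c))
                    := (con 1 :+ K) :* (a :+ b) :+ (a :+ b) :+ (con 2 :+ K) :* (b′ :+ c)) refl k a b b c ⟩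
    suc k * (a + b) + (a + b) + suc (suc k) * (b + c)
      ≡⟨ cong₂ (λ x y → x + (a + b) + y) (choose-absorption n k) (choose-absorption n (suc k)) ⟩
    suc n * a + (a + b) + suc n * b
      ≡⟨ solve 3 (λ N a b → (con 1 :+ N) :* a :+ (a :+ b) :+ (con 1 :+ N) :* b
                    := (con 2 :+ N) :* (a :+ b)) refl n a b ⟩
    suc (suc n) * (a + b) ∎
    where
    a b c : ℕ
    a = n choose k
    b = n choose suc k
    c = n choose suc (suc k)

  choose-absorption′ : ∀ t s → suc t * (s + suc t) choose suc t ≡ suc (t + s) * (t + s) choose s
  choose-absorption′ t s = begin
    suc t * (s + suc t) choose suc t    ≡⟨ cong (λ n → suc t * n choose suc t) (trans (+-suc s t) (cong suc (+-comm s t))) ⟩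
    suc t * suc (t + s) choose suc t    ≡⟨ choose-absorption (t + s) t ⟩
    suc (t + s) * (t + s) choose t      ≡⟨ cong (suc (t + s) *_) (choose-complement t s refl) ⟩
    suc (t + s) * (t + s) choose s      ∎

  ∑< : ℕ → (ℕ → ℕ) → ℕ
  ∑< zero    f = 0
  ∑< (suc L) f = f 0 + ∑< L (λ t → f (suc t))

  infix 6.5 ∑<
  syntax ∑< L (λ t → e) = ∑[ t < L ] e

  ∑⁺ : ℕ → (ℕ → ℕ → ℕ) → ℕ
  ∑⁺ zero    f = f 0 0
  ∑⁺ (suc w) f = ∑⁺ w (λ x y → f x (suc y)) + f (suc w) 0

  infix 6.5 ∑⁺
  syntax ∑⁺ w (λ x y → e) = ∑[ x + y ≡ w ] e

  ∑<-snoc : ∀ L (f : ℕ → ℕ) → ∑[ t < suc L ] f t ≡ ∑[ t < L ] f t + f L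
  ∑<-snoc zero    f = +-comm (f 0) 0
  ∑<-snoc (suc L) f = trans (cong (f 0 +_) (∑<-snoc L (λ t → f (suc t)))) (sym (+-assoc (f 0) _ _))

  ∑<-zero : ∀ L (f : ℕ → ℕ) → (∀ t → f t ≡ 0) → ∑[ t < L ] f t ≡ 0
  ∑<-zero zero    f f≗0 = refl
  ∑<-zero (suc L) f f≗0 = cong₂ _+_ (f≗0 0) (∑<-zero L _ (λ t → f≗0 (suc t)))

  ∑<-vanishing-tail : ∀ L K (f : ℕ → ℕ) → (∀ t → L ≤ t → f t ≡ 0) → ∑[ t < L + K ] f t ≡ ∑[ t < L ] f t
  ∑<-vanishing-tail zero    K f tail≗0 = ∑<-zero K f (λ t → tail≗0 t z≤n)
  ∑<-vanishing-tail (suc L) K f tail≗0 =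
    cong (f 0 +_) (∑<-vanishing-tail L K (λ t → f (suc t)) (λ t L≤t → tail≗0 (suc t) (s≤s L≤t)))

  ∑<-* : ∀ L k (f : ℕ → ℕ) → ∑[ t < L ] (k * f t) ≡ k * (∑[ t < L ] f t)
  ∑<-* zero    k f = sym (*-zeroʳ k)
  ∑<-* (suc L) k f = trans (cong (k * f 0 +_) (∑<-* L k (λ t → f (suc t)))) (sym (*-distribˡ-+ k _ _))

  ∑<-telescope : ∀ (f g : ℕ → ℕ) → (∀ j → f j + g (suc j) ≡ g j) → ∀ L → ∑[ j < L ] f j + g L ≡ g 0
  ∑<-telescope f g step zero    = refl
  ∑<-telescope f g step (suc L) = begin
    ∑[ j < suc L ] f j + g (suc L)       ≡⟨ cong (_+ g (suc L)) (∑<-snoc L f) ⟩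
    ∑[ j < L ] f j + f L + g (suc L)     ≡⟨ +-assoc (∑< L f) (f L) (g (suc L)) ⟩
    ∑[ j < L ] f j + (f L + g (suc L))   ≡⟨ cong (∑< L f +_) (step L) ⟩
    ∑[ j < L ] f j + g L                 ≡⟨ ∑<-telescope f g step L ⟩
    g 0                                  ∎

  sumFrom1≡∑< : ∀ k (f : ℕ → ℕ) → sumFrom1 k f ≡ ∑[ t < k ] f (suc t)
  sumFrom1≡∑< zero    f = refl
  sumFrom1≡∑< (suc k) f = trans (cong (_+ f (suc k)) (sumFrom1≡∑< k f)) (sym (∑<-snoc k (λ t → f (suc t))))

  ∑⁺-cong : ∀ w {f g : ℕ → ℕ → ℕ} → (∀ x y → x + y ≡ w → f x y ≡ g x y) →
            ∑[ x + y ≡ w ] f x y ≡ ∑[ x + y ≡ w ] g x y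
  ∑⁺-cong zero    f≗g = f≗g 0 0 refl
  ∑⁺-cong (suc w) f≗g = cong₂ _+_
    (∑⁺-cong w (λ x y x+y≡w → f≗g x (suc y) (trans (+-suc x y) (cong suc x+y≡w))))
    (f≗g (suc w) 0 (+-identityʳ _))

  ∑⁺-+ : ∀ w (f g : ℕ → ℕ → ℕ) →
         ∑[ x + y ≡ w ] (f x y + g x y) ≡ ∑[ x + y ≡ w ] f x y + ∑[ x + y ≡ w ] g x y
  ∑⁺-+ zero    f g = refl
  ∑⁺-+ (suc w) f g = begin
    ∑⁺ w (λ x y → f x (suc y) + g x (suc y)) + (f (suc w) 0 + g (suc w) 0)
      ≡⟨ cong (_+ (f (suc w) 0 + g (suc w) 0)) (∑⁺-+ w (λ x y → f x (suc y)) (λ x y → g x (suc y))) ⟩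
    ∑⁺ w (λ x y → f x (suc y)) + ∑⁺ w (λ x y → g x (suc y)) + (f (suc w) 0 + g (suc w) 0)
      ≡⟨ interchange (∑⁺ w (λ x y → f x (suc y))) _ _ _ ⟩
    ∑⁺ w (λ x y → f x (suc y)) + f (suc w) 0 + (∑⁺ w (λ x y → g x (suc y)) + g (suc w) 0) ∎

  ∑⁺-* : ∀ w k (f : ℕ → ℕ → ℕ) → ∑[ x + y ≡ w ] (k * f x y) ≡ k * (∑[ x + y ≡ w ] f x y)
  ∑⁺-* zero    k f = refl
  ∑⁺-* (suc w) k f =
    trans (cong (_+ k * f (suc w) 0) (∑⁺-* w k (λ x y → f x (suc y)))) (sym (*-distribˡ-+ k _ _))

  ∑⁺-constant : ∀ w k → ∑[ x + y ≡ w ] k ≡ suc w * k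
  ∑⁺-constant zero    k = sym (*-identityˡ k)
  ∑⁺-constant (suc w) k = trans (cong (_+ k) (∑⁺-constant w k)) (+-comm (suc w * k) k)

  ∑⁺-unconsˡ : ∀ w (f : ℕ → ℕ → ℕ) →
               ∑[ x + y ≡ suc w ] f x y ≡ f 0 (suc w) + ∑[ x + y ≡ w ] f (suc x) y
  ∑⁺-unconsˡ zero    f = refl
  ∑⁺-unconsˡ (suc w) f = trans (cong (_+ f (suc (suc w)) 0) (∑⁺-unconsˡ w (λ x y → f x (suc y))))
                                (+-assoc (f 0 (suc (suc w))) _ _)

  ∑⁺≡∑< : ∀ w (g : ℕ → ℕ) → ∑[ x + y ≡ w ] g x ≡ ∑[ t < suc w ] g t
  ∑⁺≡∑< zero    g = +-comm 0 (g 0)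
  ∑⁺≡∑< (suc w) g = trans (∑⁺-unconsˡ w (λ x _ → g x)) (cong (g 0 +_) (∑⁺≡∑< w (λ t → g (suc t))))

  ∑⁺-swap : ∀ w (f : ℕ → ℕ → ℕ) → ∑[ x + y ≡ w ] f y x ≡ ∑[ x + y ≡ w ] f x y
  ∑⁺-swap zero    f = refl
  ∑⁺-swap (suc w) f = begin
    ∑⁺ w (λ x y → f (suc y) x) + f 0 (suc w)   ≡⟨ cong (_+ f 0 (suc w)) (∑⁺-swap w (λ x y → f (suc x) y)) ⟩
    ∑⁺ w (λ x y → f (suc x) y) + f 0 (suc w)   ≡⟨ +-comm _ (f 0 (suc w)) ⟩
    f 0 (suc w) + ∑⁺ w (λ x y → f (suc x) y)   ≡⟨ ∑⁺-unconsˡ w f ⟨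
    ∑⁺ (suc w) f                               ∎

  ∑⁺-pascal : ∀ w (F G H : ℕ → ℕ → ℕ) → (∀ x → F x 0 ≡ G x 0) →
              (∀ x y → F x (suc y) ≡ G x (suc y) + H x y) →
              ∑[ x + y ≡ suc w ] F x y ≡ ∑[ x + y ≡ suc w ] G x y + ∑[ x + y ≡ w ] H x y
  ∑⁺-pascal w F G H F₀≡G₀ F≗G+H = begin
    ∑⁺ w (λ x y → F x (suc y)) + F (suc w) 0
      ≡⟨ cong₂ _+_ (∑⁺-cong w (λ x y _ → F≗G+H x y)) (F₀≡G₀ (suc w)) ⟩
    ∑⁺ w (λ x y → G x (suc y) + H x y) + G (suc w) 0
      ≡⟨ cong (_+ G (suc w) 0) (∑⁺-+ w (λ x y → G x (suc y)) H) ⟩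
    ∑⁺ w (λ x y → G x (suc y)) + ∑⁺ w H + G (suc w) 0
      ≡⟨ xy∙z≈xz∙y (∑⁺ w (λ x y → G x (suc y))) (∑⁺ w H) (G (suc w) 0) ⟩
    ∑⁺ w (λ x y → G x (suc y)) + G (suc w) 0 + ∑⁺ w H ∎

  ∑⁺-split : ∀ p q (f : ℕ → ℕ → ℕ) →
             ∑[ x + y ≡ suc p + q ] f x y ≡ ∑[ t + y ≡ q ] f (suc p + t) y + ∑[ t + x ≡ p ] f x (suc q + t)
  ∑⁺-split zero    q f = begin
    ∑⁺ (suc q) f                                          ≡⟨ ∑⁺-unconsˡ q f ⟩
    f 0 (suc q) + ∑⁺ q (λ t y → f (suc t) y)              ≡⟨ +-comm (f 0 (suc q)) _ ⟩
    ∑⁺ q (λ t y → f (suc t) y) + f 0 (suc q)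
      ≡⟨ cong (λ z → ∑⁺ q (λ t y → f (suc t) y) + f 0 z) (+-identityʳ (suc q)) ⟨
    ∑⁺ q (λ t y → f (suc t) y) + f 0 (suc q + 0)          ∎
  ∑⁺-split (suc p) q f = begin
    ∑⁺ (suc (suc p + q)) f
      ≡⟨ ∑⁺-unconsˡ (suc p + q) f ⟩
    f 0 (suc (suc p + q)) + ∑⁺ (suc p + q) (λ x y → f (suc x) y)
      ≡⟨ cong (f 0 (suc (suc p + q)) +_) (∑⁺-split p q (λ x y → f (suc x) y)) ⟩
    f 0 (suc (suc p + q)) + (right + left)
      ≡⟨ x∙yz≈y∙zx (f 0 (suc (suc p + q))) right left ⟩
    right + (left + f 0 (suc (suc p + q)))
      ≡⟨ cong (λ z → right + (left + f 0 (suc z))) (trans (cong suc (+-comm p q)) (sym (+-suc q p))) ⟩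
    right + ∑⁺ (suc p) (λ t x → f x (suc q + t)) ∎
    where
    right left : ℕ
    right = ∑⁺ q (λ t y → f (suc (suc p + t)) y)
    left  = ∑⁺ p (λ t x → f (suc x) (suc q + t))

  -- Vandermonde-type identities

  vandermonde : ∀ a b k → ∑[ i + j ≡ k ] (a choose i * b choose j) ≡ (a + b) choose k
  vandermonde zero    b zero    = *-identityʳ 1
  vandermonde zero    b (suc k) = begin
    ∑⁺ (suc k) (λ i j → 0 choose i * b choose j)       ≡⟨ ∑⁺-unconsˡ k (λ i j → 0 choose i * b choose j) ⟩
    1 * b choose suc k + ∑⁺ k (λ i j → 0)              ≡⟨ cong₂ _+_ (*-identityˡ _) (∑⁺-constant k 0) ⟩
    b choose suc k + suc k * 0                         ≡⟨ cong (b choose suc k +_) (*-zeroʳ (suc k)) ⟩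
    b choose suc k + 0                                 ≡⟨ +-identityʳ _ ⟩
    b choose suc k                                     ∎
  vandermonde (suc a) b zero    = refl
  vandermonde (suc a) b (suc k) = begin
    ∑⁺ (suc k) (λ i j → suc a choose i * b choose j)
      ≡⟨ ∑⁺-unconsˡ k (λ i j → suc a choose i * b choose j) ⟩
    1 * b choose suc k + ∑⁺ k (λ i j → (a choose i + a choose suc i) * b choose j)
      ≡⟨ cong (1 * b choose suc k +_) (trans (∑⁺-cong k (λ i j _ → *-distribʳ-+ (b choose j) (a choose i) _))
                                             (∑⁺-+ k (λ i j → a choose i * b choose j) (λ i j → a choose suc i * b choose j))) ⟩
    1 * b choose suc k + (∑⁺ k (λ i j → a choose i * b choose j) + ∑⁺ k (λ i j → a choose suc i * b choose j))
      ≡⟨ x∙yz≈y∙xz (1 * b choose suc k) (∑⁺ k (λ i j → a choose i * b choose j)) _ ⟩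
    ∑⁺ k (λ i j → a choose i * b choose j) + (1 * b choose suc k + ∑⁺ k (λ i j → a choose suc i * b choose j))
      ≡⟨ cong (∑⁺ k (λ i j → a choose i * b choose j) +_) (∑⁺-unconsˡ k (λ i j → a choose i * b choose j)) ⟨
    ∑⁺ k (λ i j → a choose i * b choose j) + ∑⁺ (suc k) (λ i j → a choose i * b choose j)
      ≡⟨ cong₂ _+_ (vandermonde a b k) (vandermonde a b (suc k)) ⟩
    (a + b) choose k + (a + b) choose suc k ∎

  vandermonde-shifted : ∀ a k w → ∑[ t + s ≡ w ] (a choose (k + t) * w choose s) ≡ (a + w) choose (k + w)
  vandermonde-shifted a zero    w = vandermonde a w w
  vandermonde-shifted a (suc p) w = begin
    ∑⁺ w (λ t s → a choose (suc p + t) * w choose s)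
      ≡⟨ +-identityʳ _ ⟨
    ∑⁺ w (λ t s → a choose (suc p + t) * w choose s) + 0
      ≡⟨ cong (∑⁺ w (λ t s → a choose (suc p + t) * w choose s) +_) low-terms≡0 ⟨
    ∑⁺ w (λ t s → a choose (suc p + t) * w choose s) + ∑⁺ p (λ t i → a choose i * w choose (suc w + t))
      ≡⟨ ∑⁺-split p w (λ i j → a choose i * w choose j) ⟨
    ∑⁺ (suc p + w) (λ i j → a choose i * w choose j)
      ≡⟨ vandermonde a w (suc p + w) ⟩
    (a + w) choose (suc p + w) ∎
    where
    low-terms≡0 : ∑[ t + i ≡ p ] (a choose i * w choose (suc w + t)) ≡ 0
    low-terms≡0 = begin
      ∑⁺ p (λ t i → a choose i * w choose (suc w + t))
        ≡⟨ ∑⁺-cong p (λ t i _ → trans (cong (a choose i *_) (n<k⇒choose≡0 (s≤s (m≤m+n w t)))) (*-zeroʳ (a choose i))) ⟩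
      ∑⁺ p (λ t i → 0)  ≡⟨ ∑⁺-constant p 0 ⟩
      suc p * 0         ≡⟨ *-zeroʳ (suc p) ⟩
      0                 ∎

  hockey-stick : ∀ c d → ∑[ y + y′ ≡ d ] (c + y) choose c ≡ suc (c + d) choose suc c
  hockey-stick c zero    = begin
    (c + 0) choose c                       ≡⟨ cong (_choose c) (+-identityʳ c) ⟩
    c choose c                             ≡⟨ +-identityʳ _ ⟨
    c choose c + 0                         ≡⟨ cong (c choose c +_) (n<k⇒choose≡0 (n<1+n c)) ⟨
    c choose c + c choose suc c            ≡⟨ cong (λ n → suc n choose suc c) (+-identityʳ c) ⟨
    suc (c + 0) choose suc c               ∎
  hockey-stick c (suc d) = begin
    ∑⁺ d (λ y y′ → (c + y) choose c) + (c + suc d) choose c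
      ≡⟨ cong₂ _+_ (hockey-stick c d) (cong (_choose c) (+-suc c d)) ⟩
    suc (c + d) choose suc c + suc (c + d) choose c
      ≡⟨ +-comm (suc (c + d) choose suc c) _ ⟩
    suc (suc (c + d)) choose suc c
      ≡⟨ cong (λ n → suc n choose suc c) (+-suc c d) ⟨
    suc (c + suc d) choose suc c ∎

  upper-vandermonde : ∀ a b d →
    ∑[ y + y′ ≡ d ] ((a + y) choose a * (b + y′) choose y′) ≡ suc (a + b + d) choose suc (a + b)
  upper-vandermonde a zero    d = begin
    ∑⁺ d (λ y y′ → (a + y) choose a * y′ choose y′)
      ≡⟨ ∑⁺-cong d (λ y y′ _ → trans (cong ((a + y) choose a *_) (choose-diag y′)) (*-identityʳ _)) ⟩
    ∑⁺ d (λ y y′ → (a + y) choose a)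
      ≡⟨ hockey-stick a d ⟩
    suc (a + d) choose suc a
      ≡⟨ cong (λ n → suc (n + d) choose suc n) (+-identityʳ a) ⟨
    suc (a + 0 + d) choose suc (a + 0) ∎
  upper-vandermonde a (suc b) zero    = begin
    (a + 0) choose a * 1                             ≡⟨ cong (_* 1) (trans (cong (_choose a) (+-identityʳ a)) (choose-diag a)) ⟩
    1                                                ≡⟨ choose-diag (suc (a + suc b)) ⟨
    suc (a + suc b) choose suc (a + suc b)           ≡⟨ cong (λ n → suc n choose suc (a + suc b)) (+-identityʳ _) ⟨
    suc (a + suc b + 0) choose suc (a + suc b)       ∎
  upper-vandermonde a (suc b) (suc d) = begin
    ∑⁺ (suc d) (λ y y′ → (a + y) choose a * (suc b + y′) choose y′)
      ≡⟨ ∑⁺-pascal d (λ y y′ → (a + y) choose a * (suc b + y′) choose y′) (λ y y′ → (a + y) choose a * (b + y′) choose y′)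
                     (λ y y′ → (a + y) choose a * (suc b + y′) choose y′) (λ _ → refl) pascal ⟩
    ∑⁺ (suc d) (λ y y′ → (a + y) choose a * (b + y′) choose y′) + ∑⁺ d (λ y y′ → (a + y) choose a * (suc b + y′) choose y′)
      ≡⟨ cong₂ _+_ (upper-vandermonde a b (suc d)) (upper-vandermonde a (suc b) d) ⟩
    suc (a + b + suc d) choose suc (a + b) + suc (a + suc b + d) choose suc (a + suc b)
      ≡⟨ reindex ⟩
    suc (a + suc b + suc d) choose suc (a + suc b) ∎
    where
    pascal : ∀ y y′ → (a + y) choose a * (suc b + suc y′) choose suc y′
                    ≡ (a + y) choose a * (b + suc y′) choose suc y′ + (a + y) choose a * (suc b + y′) choose y′
    pascal y y′ = trans (cong ((a + y) choose a *_) (trans (choose-pascal b y′) (+-comm ((suc b + y′) choose y′) _)))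
                        (*-distribˡ-+ ((a + y) choose a) _ _)
    reindex : suc (a + b + suc d) choose suc (a + b) + suc (a + suc b + d) choose suc (a + suc b)
            ≡ suc (a + suc b + suc d) choose suc (a + suc b)
    reindex rewrite +-suc a b | +-suc (a + b) d = refl

  -- S₄ as a weighted single sum

  pascal-recursion-unique : (F G : ℕ → ℕ → ℕ) →
    (∀ h → F 0 h ≡ G 0 h) → (∀ w → F w 0 ≡ G w 0) →
    (∀ w h → F (suc w) (suc h) ≡ F (suc w) h + F w (suc h)) →
    (∀ w h → G (suc w) (suc h) ≡ G (suc w) h + G w (suc h)) →
    ∀ w h → F w h ≡ G w h
  pascal-recursion-unique F G left bottom F-rec G-rec = go
    where
    go : ∀ w h → F w h ≡ G w h
    go zero    h       = left h
    go (suc w) zero    = bottom (suc w)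
    go (suc w) (suc h) = begin
      F (suc w) (suc h)              ≡⟨ F-rec w h ⟩
      F (suc w) h + F w (suc h)      ≡⟨ cong₂ _+_ (go (suc w) h) (go w (suc h)) ⟩
      G (suc w) h + G w (suc h)      ≡⟨ G-rec w h ⟨
      G (suc w) (suc h)              ∎

  doubleSum : ℕ → ℕ → ℕ → ℕ → ℕ
  doubleSum c d w h =
    ∑[ x + x′ ≡ w ] ∑[ y + y′ ≡ d ] ((c + x + y) choose (c + x) * (x′ + (h + y′)) choose (h + y′))

  weightedSum : ℕ → ℕ → ℕ → ℕ → ℕ
  weightedSum c d w h =
    ∑[ t + s ≡ w ] (suc t * suc (c + d) choose suc (c + t) * (s + (h + suc t)) choose (h + suc t))

  doubleSum-rec : ∀ c d w h → doubleSum c d (suc w) (suc h) ≡ doubleSum c d (suc w) h + doubleSum c d w (suc h)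
  doubleSum-rec c d w h = ∑⁺-pascal w (inner (suc h)) (inner h) (inner (suc h)) edge step
    where
    inner : ℕ → ℕ → ℕ → ℕ
    inner h x x′ = ∑[ y + y′ ≡ d ] ((c + x + y) choose (c + x) * (x′ + (h + y′)) choose (h + y′))
    edge : ∀ x → inner (suc h) x 0 ≡ inner h x 0
    edge x = ∑⁺-cong d (λ y y′ _ →
      cong ((c + x + y) choose (c + x) *_) (trans (choose-diag (suc h + y′)) (sym (choose-diag (h + y′)))))
    step : ∀ x x′ → inner (suc h) x (suc x′) ≡ inner h x (suc x′) + inner (suc h) x x′
    step x x′ = trans
      (∑⁺-cong d (λ y y′ _ → trans (cong ((c + x + y) choose (c + x) *_) (choose-pascal x′ (h + y′)))
                                    (*-distribˡ-+ ((c + x + y) choose (c + x)) _ _)))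
      (∑⁺-+ d _ _)

  weightedSum-rec : ∀ c d w h → weightedSum c d (suc w) (suc h) ≡ weightedSum c d (suc w) h + weightedSum c d w (suc h)
  weightedSum-rec c d w h = ∑⁺-pascal w (term (suc h)) (term h) (term (suc h)) edge step
    where
    term : ℕ → ℕ → ℕ → ℕ
    term h t s = suc t * suc (c + d) choose suc (c + t) * (s + (h + suc t)) choose (h + suc t)
    edge : ∀ t → term (suc h) t 0 ≡ term h t 0
    edge t = cong (suc t * suc (c + d) choose suc (c + t) *_)
                  (trans (choose-diag (suc h + suc t)) (sym (choose-diag (h + suc t))))
    step : ∀ t s → term (suc h) t (suc s) ≡ term h t (suc s) + term (suc h) t s
    step t s = trans (cong (suc t * suc (c + d) choose suc (c + t) *_) (choose-pascal s (h + suc t)))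
                     (*-distribˡ-+ (suc t * suc (c + d) choose suc (c + t)) _ _)

  doubleSum-left : ∀ c d h → doubleSum c d 0 h ≡ suc (c + d) choose suc c
  doubleSum-left c d h = trans (∑⁺-cong d summand) (hockey-stick c d)
    where
    summand : ∀ y y′ → y + y′ ≡ d → (c + 0 + y) choose (c + 0) * (h + y′) choose (h + y′) ≡ (c + y) choose c
    summand y y′ _ = begin
      (c + 0 + y) choose (c + 0) * (h + y′) choose (h + y′)
        ≡⟨ cong₂ (λ k n → (k + y) choose k * n) (+-identityʳ c) (choose-diag (h + y′)) ⟩
      (c + y) choose c * 1                                  ≡⟨ *-identityʳ _ ⟩
      (c + y) choose c                                      ∎

  weightedSum-left : ∀ c d h → weightedSum c d 0 h ≡ suc (c + d) choose suc c
  weightedSum-left c d h = begin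
    1 * suc (c + d) choose suc (c + 0) * (h + 1) choose (h + 1)
      ≡⟨ cong₂ (λ k n → 1 * suc (c + d) choose suc k * n) (+-identityʳ c) (choose-diag (h + 1)) ⟩
    1 * suc (c + d) choose suc c * 1
      ≡⟨ trans (*-identityʳ _) (*-identityˡ _) ⟩
    suc (c + d) choose suc c ∎

  doubleSum-bottom : ∀ c d w → doubleSum c d w 0 ≡ suc w * suc (c + w + d) choose suc (c + w)
  doubleSum-bottom c d w = begin
    ∑⁺ w (λ x x′ → ∑⁺ d (λ y y′ → (c + x + y) choose (c + x) * (x′ + y′) choose y′))
      ≡⟨ ∑⁺-cong w (λ x x′ x+x′≡w → trans (upper-vandermonde (c + x) x′ d)
                       (cong (λ n → suc (n + d) choose suc n) (trans (+-assoc c x x′) (cong (c +_) x+x′≡w)))) ⟩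
    ∑⁺ w (λ _ _ → suc (c + w + d) choose suc (c + w))
      ≡⟨ ∑⁺-constant w _ ⟩
    suc w * suc (c + w + d) choose suc (c + w) ∎

  weightedSum-bottom : ∀ c d w → weightedSum c d w 0 ≡ suc w * suc (c + w + d) choose suc (c + w)
  weightedSum-bottom c d w = begin
    ∑⁺ w (λ t s → suc t * suc (c + d) choose suc (c + t) * (s + suc t) choose suc t)
      ≡⟨ ∑⁺-cong w summand ⟩
    ∑⁺ w (λ t s → suc w * (suc (c + d) choose suc (c + t) * w choose s))
      ≡⟨ ∑⁺-* w (suc w) _ ⟩
    suc w * ∑⁺ w (λ t s → suc (c + d) choose (suc c + t) * w choose s)
      ≡⟨ cong (suc w *_) (vandermonde-shifted (suc (c + d)) (suc c) w) ⟩
    suc w * suc (c + d + w) choose suc (c + w)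
      ≡⟨ cong (λ n → suc w * suc n choose suc (c + w)) (xy∙z≈xz∙y c d w) ⟩
    suc w * suc (c + w + d) choose suc (c + w) ∎
    where
    summand : ∀ t s → t + s ≡ w → suc t * suc (c + d) choose suc (c + t) * (s + suc t) choose suc t
                                 ≡ suc w * (suc (c + d) choose suc (c + t) * w choose s)
    summand t s t+s≡w = begin
      suc t * a * (s + suc t) choose suc t      ≡⟨ *-CS.xy∙z≈y∙xz (suc t) a _ ⟩
      a * (suc t * (s + suc t) choose suc t)    ≡⟨ cong (a *_) (choose-absorption′ t s) ⟩
      a * (suc (t + s) * (t + s) choose s)      ≡⟨ cong (λ n → a * (suc n * n choose s)) t+s≡w ⟩
      a * (suc w * w choose s)                  ≡⟨ *-CS.x∙yz≈y∙xz a (suc w) _ ⟩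
      suc w * (a * w choose s)                  ∎
      where
      a : ℕ
      a = suc (c + d) choose suc (c + t)

  doubleSum≡weightedSum : ∀ c d w h → doubleSum c d w h ≡ weightedSum c d w h
  doubleSum≡weightedSum c d = pascal-recursion-unique (doubleSum c d) (weightedSum c d)
    (λ h → trans (doubleSum-left c d h) (sym (weightedSum-left c d h)))
    (λ w → trans (doubleSum-bottom c d w) (sym (weightedSum-bottom c d w)))
    (doubleSum-rec c d) (weightedSum-rec c d)

  binomialPair : ℕ → ℕ → ℕ → ℕ
  binomialPair m n k = (m + n) choose (m + k) * (m + n) choose (n + k)

  binomialPair-vanishˡ : ∀ m n k → m < k → binomialPair m n k ≡ 0
  binomialPair-vanishˡ m n k m<k = trans
    (cong ((m + n) choose (m + k) *_) (n<k⇒choose≡0 (subst (_< n + k) (+-comm n m) (+-monoʳ-< n m<k))))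
    (*-zeroʳ ((m + n) choose (m + k)))

  binomialPair-vanishʳ : ∀ m n k → n < k → binomialPair m n k ≡ 0
  binomialPair-vanishʳ m n k n<k = cong (_* (m + n) choose (n + k)) (n<k⇒choose≡0 (+-monoʳ-< m n<k))

  weightedTail : ℕ → ℕ → ℕ
  weightedTail m n = ∑[ t < m + n ] (suc t * binomialPair m n (3 + t))

  weightedTail≡0 : ∀ m n → (∀ t → binomialPair m n (3 + t) ≡ 0) → weightedTail m n ≡ 0
  weightedTail≡0 m n pair≡0 = ∑<-zero (m + n) _ (λ t → trans (cong (suc t *_) (pair≡0 t)) (*-zeroʳ (suc t)))

  ∸-suc-cancel : ∀ {a} e b → a ≡ suc e + b → a ∸ b ∸ 1 ≡ e
  ∸-suc-cancel e b refl = cong (_∸ 1) (m+n∸n≡m (suc e) b)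

  S4-summand : ∀ x x′ y y′ → let m = 3 + (x + x′); n = 3 + (y + y′); a = suc x; b = suc y′ in
    ((m + n + a ∸ b ∸ 1) C (m + a + 1)) * ((m + n + b ∸ a ∸ 1) C (n + b + 1))
    ≡ (5 + (x + x′) + x + y) choose (5 + (x + x′) + x) * (x′ + (5 + (y + y′) + y′)) choose (5 + (y + y′) + y′)
  S4-summand x x′ y y′ = cong₂ _*_ (C≡choose (∸-suc-cancel (5 + (x + x′) + x + y) (suc y′) top₁) bottom₁)
                                  (C≡choose (∸-suc-cancel (x′ + (5 + (y + y′) + y′)) (suc x) top₂) bottom₂)
    where
    top₁ : 3 + (x + x′) + (3 + (y + y′)) + suc x ≡ suc (5 + (x + x′) + x + y) + suc y′
    top₁ = solve 4 (λ x x′ y y′ → con 3 :+ (x :+ x′) :+ (con 3 :+ (y :+ y′)) :+ (con 1 :+ x)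
                                := con 1 :+ (con 5 :+ (x :+ x′) :+ x :+ y) :+ (con 1 :+ y′)) refl x x′ y y′
    bottom₁ : 3 + (x + x′) + suc x + 1 ≡ 5 + (x + x′) + x
    bottom₁ = solve 2 (λ x x′ → con 3 :+ (x :+ x′) :+ (con 1 :+ x) :+ con 1 := con 5 :+ (x :+ x′) :+ x) refl x x′
    top₂ : 3 + (x + x′) + (3 + (y + y′)) + suc y′ ≡ suc (x′ + (5 + (y + y′) + y′)) + suc x
    top₂ = solve 4 (λ x x′ y y′ → con 3 :+ (x :+ x′) :+ (con 3 :+ (y :+ y′)) :+ (con 1 :+ y′)
                                := con 1 :+ (x′ :+ (con 5 :+ (y :+ y′) :+ y′)) :+ (con 1 :+ x)) refl x x′ y y′
    bottom₂ : 3 + (y + y′) + suc y′ + 1 ≡ 5 + (y + y′) + y′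
    bottom₂ = solve 2 (λ y y′ → con 3 :+ (y :+ y′) :+ (con 1 :+ y′) :+ con 1 := con 5 :+ (y :+ y′) :+ y′) refl y y′

  S4≡doubleSum : ∀ w d → S4 (3 + w) (3 + d) ≡ doubleSum (5 + w) d w (5 + d)
  S4≡doubleSum w d = begin
    sumFrom1 (suc w) (λ a → sumFrom1 (suc d) (summand a))
      ≡⟨ sumFrom1≡∑< (suc w) _ ⟩
    ∑[ a < suc w ] sumFrom1 (suc d) (summand (suc a))
      ≡⟨ ∑⁺≡∑< w _ ⟨
    ∑[ x + x′ ≡ w ] sumFrom1 (suc d) (summand (suc x))
      ≡⟨ ∑⁺-cong w (λ x x′ x+x′≡w → begin
           sumFrom1 (suc d) (summand (suc x))
             ≡⟨ trans (sumFrom1≡∑< (suc d) _) (sym (∑⁺≡∑< d _)) ⟩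
           ∑[ b + z ≡ d ] summand (suc x) (suc b)
             ≡⟨ ∑⁺-swap d (λ b _ → summand (suc x) (suc b)) ⟨
           ∑[ y + y′ ≡ d ] summand (suc x) (suc y′)
             ≡⟨ ∑⁺-cong d (λ y y′ y+y′≡d → summand≡ x x′ y y′ x+x′≡w y+y′≡d) ⟩
           ∑[ y + y′ ≡ d ] ((5 + w + x + y) choose (5 + w + x) * (x′ + (5 + d + y′)) choose (5 + d + y′)) ∎) ⟩
    doubleSum (5 + w) d w (5 + d) ∎
    where
    summand : ℕ → ℕ → ℕ
    summand a b = ((3 + w + (3 + d) + a ∸ b ∸ 1) C (3 + w + a + 1)) * ((3 + w + (3 + d) + b ∸ a ∸ 1) C (3 + d + b + 1))
    summand≡ : ∀ x x′ y y′ → x + x′ ≡ w → y + y′ ≡ d →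
      summand (suc x) (suc y′) ≡ (5 + w + x + y) choose (5 + w + x) * (x′ + (5 + d + y′)) choose (5 + d + y′)
    summand≡ x x′ y y′ refl refl = S4-summand x x′ y y′

  weightedSum≡weightedTail : ∀ w d → weightedSum (5 + w) d w (5 + d) ≡ weightedTail (3 + w) (3 + d)
  weightedSum≡weightedTail w d = begin
    weightedSum (5 + w) d w (5 + d)     ≡⟨ ∑⁺-cong w summand≡ ⟩
    ∑[ t + s ≡ w ] g t                   ≡⟨ ∑⁺≡∑< w g ⟩
    ∑[ t < suc w ] g t                   ≡⟨ ∑<-vanishing-tail (suc w) (5 + d) g tail≡0 ⟨
    ∑[ t < suc w + (5 + d) ] g t
      ≡⟨ cong (λ L → ∑< L g) (solve 2 (λ w d → con 1 :+ w :+ (con 5 :+ d) := con 3 :+ w :+ (con 3 :+ d)) refl w d) ⟩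
    weightedTail (3 + w) (3 + d)         ∎
    where
    g : ℕ → ℕ
    g t = suc t * binomialPair (3 + w) (3 + d) (3 + t)
    tail≡0 : ∀ t → suc w ≤ t → g t ≡ 0
    tail≡0 t w<t = trans (cong (suc t *_) (binomialPair-vanishˡ (3 + w) (3 + d) (3 + t) (+-monoʳ-< 3 w<t))) (*-zeroʳ (suc t))
    summand≡ : ∀ t s → t + s ≡ w →
      suc t * suc (5 + w + d) choose suc (5 + w + t) * (s + (5 + d + suc t)) choose (5 + d + suc t) ≡ g t
    summand≡ t s refl = begin
      suc t * suc (5 + (t + s) + d) choose suc (5 + (t + s) + t) * (s + (5 + d + suc t)) choose (5 + d + suc t)
        ≡⟨ *-assoc (suc t) (suc (5 + (t + s) + d) choose suc (5 + (t + s) + t)) _ ⟩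
      suc t * (suc (5 + (t + s) + d) choose suc (5 + (t + s) + t) * (s + (5 + d + suc t)) choose (5 + d + suc t))
        ≡⟨ cong (suc t *_) (cong₂ _*_
             (cong₂ _choose_ (solve 3 (λ t s d → con 6 :+ (t :+ s) :+ d := con 3 :+ (t :+ s) :+ (con 3 :+ d)) refl t s d)
                             (solve 2 (λ t s → con 6 :+ (t :+ s) :+ t := con 3 :+ (t :+ s) :+ (con 3 :+ t)) refl t s))
             (cong₂ _choose_ (solve 3 (λ t s d → s :+ (con 5 :+ d :+ (con 1 :+ t)) := con 3 :+ (t :+ s) :+ (con 3 :+ d)) refl t s d)
                             (solve 2 (λ t d → con 5 :+ d :+ (con 1 :+ t) := con 3 :+ d :+ (con 3 :+ t)) refl t d))) ⟩
      g t ∎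

  S4≡weightedTail : ∀ m n → S4 m n ≡ weightedTail m n
  S4≡weightedTail 0 n = sym (weightedTail≡0 0 n (λ t → binomialPair-vanishˡ 0 n (3 + t) z<s))
  S4≡weightedTail 1 n = sym (weightedTail≡0 1 n (λ t → binomialPair-vanishˡ 1 n (3 + t) (s<s z<s)))
  S4≡weightedTail 2 n = sym (weightedTail≡0 2 n (λ t → binomialPair-vanishˡ 2 n (3 + t) (s<s (s<s z<s))))
  S4≡weightedTail m@(suc (suc (suc w))) 0 =
    trans (sumFrom1≡∑< (suc w) _) (trans (∑<-zero (suc w) _ (λ _ → refl))
          (sym (weightedTail≡0 m 0 (λ t → binomialPair-vanishʳ m 0 (3 + t) z<s))))
  S4≡weightedTail m@(suc (suc (suc w))) 1 =
    trans (sumFrom1≡∑< (suc w) _) (trans (∑<-zero (suc w) _ (λ _ → refl))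
          (sym (weightedTail≡0 m 1 (λ t → binomialPair-vanishʳ m 1 (3 + t) (s<s z<s)))))
  S4≡weightedTail m@(suc (suc (suc w))) 2 =
    trans (sumFrom1≡∑< (suc w) _) (trans (∑<-zero (suc w) _ (λ _ → refl))
          (sym (weightedTail≡0 m 2 (λ t → binomialPair-vanishʳ m 2 (3 + t) (s<s (s<s z<s))))))
  S4≡weightedTail (suc (suc (suc w))) (suc (suc (suc d))) = begin
    S4 (3 + w) (3 + d)                ≡⟨ S4≡doubleSum w d ⟩
    doubleSum (5 + w) d w (5 + d)     ≡⟨ doubleSum≡weightedSum (5 + w) d w (5 + d) ⟩
    weightedSum (5 + w) d w (5 + d)   ≡⟨ weightedSum≡weightedTail w d ⟩
    weightedTail (3 + w) (3 + d)      ∎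

  -- Evaluation of the weighted single sum

  tailSum : ℕ → ℕ → ℕ
  tailSum m n = ∑[ t < m + n ] binomialPair m n (suc t)

  central-vandermonde : ∀ m n → (m + n + (m + n)) choose (m + m) ≡ binomialPair m n 0 + tailSum m n + tailSum m n
  central-vandermonde zero n = sym (begin
    1 * n choose (n + 0) + tailSum 0 n + tailSum 0 n
      ≡⟨ cong₂ (λ a b → 1 * a + b + b) diag (∑<-zero n _ (λ t → binomialPair-vanishˡ 0 n (suc t) z<s)) ⟩
    1 * 1 + 0 + 0                                     ≡⟨⟩
    1                                                 ∎)
    where
    diag : n choose (n + 0) ≡ 1
    diag = trans (cong (n choose_) (+-identityʳ n)) (choose-diag n)
  central-vandermonde m@(suc p) n = begin
    (N + N) choose (m + m)
      ≡⟨ vandermonde N N (m + m) ⟨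
    ∑[ i + j ≡ m + m ] (N choose i * N choose j)
      ≡⟨ ∑⁺-split p m (λ i j → N choose i * N choose j) ⟩
    ∑[ t + s ≡ m ] (N choose (m + t) * N choose s) + ∑[ t + s ≡ p ] (N choose s * N choose (suc m + t))
      ≡⟨ cong₂ _+_ (∑⁺-cong m upper) (∑⁺-cong p lower) ⟩
    ∑[ t + s ≡ m ] binomialPair m n t + ∑[ t + s ≡ p ] binomialPair m n (suc t)
      ≡⟨ cong₂ _+_ (∑⁺≡∑< m (binomialPair m n)) (∑⁺≡∑< p (λ t → binomialPair m n (suc t))) ⟩
    binomialPair m n 0 + ∑[ t < m ] binomialPair m n (suc t) + ∑[ t < m ] binomialPair m n (suc t)
      ≡⟨ cong₂ (λ a b → binomialPair m n 0 + a + b) extend extend ⟩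
    binomialPair m n 0 + tailSum m n + tailSum m n ∎
    where
    N : ℕ
    N = m + n
    upper : ∀ t s → t + s ≡ m → N choose (m + t) * N choose s ≡ binomialPair m n t
    upper t s t+s≡m = cong (N choose (m + t) *_) (choose-complement s (n + t)
      (trans (solve 3 (λ t s n → s :+ (n :+ t) := t :+ s :+ n) refl t s n) (cong (_+ n) t+s≡m)))
    lower : ∀ t s → t + s ≡ p → N choose s * N choose (suc m + t) ≡ binomialPair m n (suc t)
    lower t s t+s≡p = trans (*-comm (N choose s) _) (cong₂ _*_ (cong (N choose_) (sym (+-suc m t)))
      (choose-complement s (n + suc t)
        (trans (solve 3 (λ t s n → s :+ (n :+ (con 1 :+ t)) := con 1 :+ (t :+ s) :+ n) refl t s n) (cong (λ k → suc k + n) t+s≡p))))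
    extend : ∑[ t < m ] binomialPair m n (suc t) ≡ tailSum m n
    extend = sym (∑<-vanishing-tail m n _ (λ t m≤t → binomialPair-vanishˡ m n (suc t) (s≤s m≤t)))

  firstMoment : ℕ → ℕ → ℕ
  firstMoment m n = ∑[ t < m + n ] (suc t * binomialPair m n (suc t))

  predPair : ℕ → ℕ → ℕ → ℕ
  predPair m′ n j = (m′ + n) choose (suc m′ + j) * (m′ + n) choose (n + j)

  absorption-complement : ∀ {N α p u} a r → N ≡ a + r → α ≡ p + u → a * α ≡ N * p → N * u ≡ r * α
  absorption-complement {N} {α} {p} {u} a r refl refl aα≡Np = +-cancelˡ-≡ (N * p) _ _ (begin
    N * p + N * u        ≡⟨ *-distribˡ-+ N p u ⟨
    N * (p + u)          ≡⟨ *-distribʳ-+ (p + u) a r ⟩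
    a * α + r * α        ≡⟨ cong (_+ r * α) aα≡Np ⟩
    N * p + r * α        ∎)

  -- Multiplied by N = m + n, the claim becomes ab = 2JN + r r′ for J = suc j, a = m + J,
  -- b = n + J, once N u = r α and N v = r′ β (absorption on the complementary index).
  telescoping-algebra : ∀ {m n} j r r′ {α β p q u v} → m ≡ suc j + r′ → n ≡ suc j + r →
    α ≡ p + u → β ≡ q + v → (m + suc j) * α ≡ (m + n) * p → (n + suc j) * β ≡ (m + n) * q →
    2 * (suc j * (α * β)) + (m + n) * (u * v) ≡ (m + n) * (p * q)
  telescoping-algebra {m} {n} j r r′ {α} {β} {p} {q} {u} {v} refl refl α≡p+u β≡q+v aα≡Np bβ≡Nq =
    *-cancelˡ-≡ _ _ N (begin
      N * (2 * (suc j * (α * β)) + N * (u * v))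
        ≡⟨ solve 6 (λ N J α β u v → N :* (con 2 :* (J :* (α :* β)) :+ N :* (u :* v))
                                  := con 2 :* J :* N :* α :* β :+ (N :* u) :* (N :* v)) refl N (suc j) α β u v ⟩
      2 * suc j * N * α * β + (N * u) * (N * v)
        ≡⟨ cong₂ (λ x y → 2 * suc j * N * α * β + x * y) Nu≡rα Nv≡r′β ⟩
      2 * suc j * N * α * β + (r * α) * (r′ * β)
        ≡⟨ solve 5 (λ j r r′ α β →
              con 2 :* (con 1 :+ j) :* (con 1 :+ j :+ r′ :+ (con 1 :+ j :+ r)) :* α :* β :+ (r :* α) :* (r′ :* β)
           := ((con 1 :+ j :+ r′ :+ (con 1 :+ j)) :* α) :* ((con 1 :+ j :+ r :+ (con 1 :+ j)) :* β)) refl j r r′ α β ⟩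
      ((m + suc j) * α) * ((n + suc j) * β)
        ≡⟨ cong₂ _*_ aα≡Np bβ≡Nq ⟩
      (N * p) * (N * q)
        ≡⟨ solve 3 (λ N p q → (N :* p) :* (N :* q) := N :* (N :* (p :* q))) refl N p q ⟩
      N * (N * (p * q)) ∎)
    where
    N : ℕ
    N = m + n
    Nu≡rα : N * u ≡ r * α
    Nu≡rα = absorption-complement (m + suc j) r
      (solve 3 (λ j r r′ → con 1 :+ j :+ r′ :+ (con 1 :+ j :+ r) := con 1 :+ j :+ r′ :+ (con 1 :+ j) :+ r) refl j r r′)
      α≡p+u aα≡Np
    Nv≡r′β : N * v ≡ r′ * β
    Nv≡r′β = absorption-complement (n + suc j) r′
      (solve 3 (λ j r r′ → con 1 :+ j :+ r′ :+ (con 1 :+ j :+ r) := con 1 :+ j :+ r :+ (con 1 :+ j) :+ r′) refl j r r′)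
      β≡q+v bβ≡Nq

  pascal-vanishes : ∀ N k j → N < k + j →
    suc N choose (k + suc j) ≡ 0 × N choose (k + j) ≡ 0 × N choose (k + suc j) ≡ 0
  pascal-vanishes N k j N<k+j =
      n<k⇒choose≡0 (subst (suc N <_) (sym (+-suc k j)) (s≤s N<k+j))
    , n<k⇒choose≡0 N<k+j
    , n<k⇒choose≡0 (≤-trans N<k+j (+-monoʳ-≤ k (n≤1+n j)))

  telescoping-step : ∀ m′ n j → 2 * (suc j * binomialPair (suc m′) n (suc j)) + suc (m′ + n) * predPair m′ n (suc j)
                                ≡ suc (m′ + n) * predPair m′ n j
  telescoping-step m′ n j with suc j ≤? n | suc j ≤? suc m′
  ... | yes J≤n | yes J≤m = telescoping-algebra j (n ∸ suc j) (suc m′ ∸ suc j)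
    (sym (m+[n∸m]≡n J≤m)) (sym (m+[n∸m]≡n J≤n)) (pascal (suc m′)) (pascal n) (absorb (suc m′)) (absorb n)
    where
    pascal : ∀ k → suc (m′ + n) choose (k + suc j) ≡ (m′ + n) choose (k + j) + (m′ + n) choose (k + suc j)
    pascal k rewrite +-suc k j = refl
    absorb : ∀ k → (k + suc j) * suc (m′ + n) choose (k + suc j) ≡ suc (m′ + n) * (m′ + n) choose (k + j)
    absorb k rewrite +-suc k j = choose-absorption (m′ + n) (k + j)
  ... | no J≰n | _ = vanishesˡ {β = suc (m′ + n) choose (n + suc j)} {(m′ + n) choose (n + j)} {(m′ + n) choose (n + suc j)}
      (pascal-vanishes (m′ + n) (suc m′) j (s≤s (+-monoʳ-≤ m′ (≤-pred (≰⇒> J≰n)))))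
    where
    vanishesˡ : ∀ {β q v α p u} → α ≡ 0 × p ≡ 0 × u ≡ 0 →
                2 * (suc j * (α * β)) + suc (m′ + n) * (u * v) ≡ suc (m′ + n) * (p * q)
    vanishesˡ (refl , refl , refl) rewrite *-zeroʳ j | *-zeroʳ (m′ + n) = refl
  ... | _ | no J≰m =
    vanishesʳ {α = suc (m′ + n) choose (suc m′ + suc j)} {(m′ + n) choose (suc m′ + j)} {(m′ + n) choose (suc m′ + suc j)}
      (pascal-vanishes (m′ + n) n j (subst (_< n + j) (+-comm n m′) (+-monoʳ-< n (≤-pred (≰⇒> J≰m)))))
    where
    vanishesʳ : ∀ {α p u β q v} → β ≡ 0 × q ≡ 0 × v ≡ 0 →
                2 * (suc j * (α * β)) + suc (m′ + n) * (u * v) ≡ suc (m′ + n) * (p * q)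
    vanishesʳ {α} {p} {u} (refl , refl , refl)
      rewrite *-zeroʳ α | *-zeroʳ u | *-zeroʳ p | *-zeroʳ j | *-zeroʳ (m′ + n) = refl

  firstMoment-closed : ∀ m′ n → 2 * firstMoment (suc m′) n ≡ suc (m′ + n) * predPair m′ n 0
  firstMoment-closed m′ n = begin
    2 * firstMoment (suc m′) n                 ≡⟨ ∑<-* L 2 (λ t → suc t * binomialPair (suc m′) n (suc t)) ⟨
    ∑< L f                                     ≡⟨ +-identityʳ _ ⟨
    ∑< L f + 0                                 ≡⟨ cong (∑< L f +_) last≡0 ⟨
    ∑< L f + suc (m′ + n) * predPair m′ n L
      ≡⟨ ∑<-telescope f (λ j → suc (m′ + n) * predPair m′ n j) (telescoping-step m′ n) L ⟩
    suc (m′ + n) * predPair m′ n 0             ∎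
    where
    L : ℕ
    L = suc m′ + n
    f : ℕ → ℕ
    f j = 2 * (suc j * binomialPair (suc m′) n (suc j))
    last≡0 : suc (m′ + n) * predPair m′ n L ≡ 0
    last≡0 = trans (cong (λ x → suc (m′ + n) * (x * (m′ + n) choose (n + L)))
                         (n<k⇒choose≡0 (s≤s (+-monoʳ-≤ m′ (m≤n+m n (suc m′))))))
                   (*-zeroʳ (suc (m′ + n)))

  predPair-scaled : ∀ m′ n′ → let m = suc m′; n = suc n′; N = m + n in
    N * (N * predPair m′ n 0) ≡ m * n * (N choose m * N choose m)
  predPair-scaled m′ n′ = begin
    N * (N * ((m′ + n) choose (m + 0) * (m′ + n) choose (n + 0)))
      ≡⟨ solve 3 (λ N a b → N :* (N :* (a :* b)) := (N :* a) :* (N :* b)) refl N ((m′ + n) choose (m + 0)) _ ⟩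
    N * (m′ + n) choose (m + 0) * (N * (m′ + n) choose (n + 0))
      ≡⟨ cong₂ _*_ left right ⟩
    n * A * (m * A)
      ≡⟨ solve 3 (λ m n a → n :* a :* (m :* a) := m :* n :* (a :* a)) refl m n A ⟩
    m * n * (A * A) ∎
    where
    m n N A : ℕ
    m = suc m′
    n = suc n′
    N = m + n
    A = N choose m
    left : N * (m′ + n) choose (m + 0) ≡ n * A
    left = begin
      N * (m′ + n) choose (m + 0)
        ≡⟨ cong (N *_) (choose-complement (m + 0) n′
             (solve 2 (λ m′ n′ → con 1 :+ m′ :+ con 0 :+ n′ := m′ :+ (con 1 :+ n′)) refl m′ n′)) ⟩
      N * (m′ + n) choose n′       ≡⟨ choose-absorption (m′ + n) n′ ⟨
      n * N choose n               ≡⟨ cong (n *_) (choose-complement n m (+-comm n m)) ⟩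
      n * A                        ∎
    right : N * (m′ + n) choose (n + 0) ≡ m * A
    right = begin
      N * (m′ + n) choose (n + 0)  ≡⟨ cong (N *_) (choose-complement (n + 0) m′ (trans (cong (_+ m′) (+-identityʳ n)) (+-comm n m′))) ⟩
      N * (m′ + n) choose m′       ≡⟨ choose-absorption (m′ + n) m′ ⟨
      m * A                        ∎

  ∑<-weight-shift : ∀ K (f : ℕ → ℕ) →
    ∑[ t < 2 + K ] (suc t * f (suc t)) + f 1 ≡ ∑[ t < K ] (suc t * f (3 + t)) + 2 * (∑[ t < 2 + K ] f (suc t))
  ∑<-weight-shift zero    f =
    solve 2 (λ a b → con 1 :* a :+ (con 2 :* b :+ con 0) :+ a := con 0 :+ con 2 :* (a :+ (b :+ con 0))) refl (f 1) (f 2)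
  ∑<-weight-shift (suc K) f = begin
    ∑< (3 + K) g + f 1
      ≡⟨ cong (_+ f 1) (∑<-snoc (2 + K) g) ⟩
    ∑< (2 + K) g + (3 + K) * F + f 1
      ≡⟨ xy∙z≈xz∙y (∑< (2 + K) g) _ (f 1) ⟩
    ∑< (2 + K) g + f 1 + (3 + K) * F
      ≡⟨ cong (_+ (3 + K) * F) (∑<-weight-shift K f) ⟩
    ∑< K h + 2 * ∑< (2 + K) f′ + (3 + K) * F
      ≡⟨ solve 4 (λ a b F K → a :+ con 2 :* b :+ (con 3 :+ K) :* F := a :+ (con 1 :+ K) :* F :+ con 2 :* (b :+ F))
               refl (∑< K h) (∑< (2 + K) f′) F K ⟩
    ∑< K h + suc K * F + 2 * (∑< (2 + K) f′ + F)
      ≡⟨ cong₂ (λ x y → x + 2 * y) (∑<-snoc K h) (∑<-snoc (2 + K) f′) ⟨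
    ∑< (suc K) h + 2 * ∑< (3 + K) f′ ∎
    where
    g h f′ : ℕ → ℕ
    g t = suc t * f (suc t)
    h t = suc t * f (3 + t)
    f′ t = f (suc t)
    F : ℕ
    F = f (3 + K)

  weightedTail-shift : ∀ m′ n′ → let m = suc m′; n = suc n′ in
    weightedTail m n + 2 * tailSum m n ≡ firstMoment m n + binomialPair m n 1
  weightedTail-shift m′ n′ = begin
    ∑< (m + n) h + 2 * ∑< (m + n) f′        ≡⟨ cong (λ L → ∑< L h + 2 * ∑< L f′) L≡2+K ⟩
    ∑< (2 + K) h + 2 * ∑< (2 + K) f′        ≡⟨ cong (_+ 2 * ∑< (2 + K) f′) h-tail ⟩
    ∑< K h + 2 * ∑< (2 + K) f′              ≡⟨ ∑<-weight-shift K (binomialPair m n) ⟨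
    ∑< (2 + K) g + binomialPair m n 1       ≡⟨ cong (λ L → ∑< L g + binomialPair m n 1) L≡2+K ⟨
    ∑< (m + n) g + binomialPair m n 1       ∎
    where
    m n K : ℕ
    m = suc m′
    n = suc n′
    K = m′ + n′
    g h f′ : ℕ → ℕ
    g t = suc t * binomialPair m n (suc t)
    h t = suc t * binomialPair m n (3 + t)
    f′ t = binomialPair m n (suc t)
    L≡2+K : m + n ≡ 2 + K
    L≡2+K = cong suc (+-suc m′ n′)
    h-tail : ∑< (2 + K) h ≡ ∑< K h
    h-tail = trans (cong (λ L → ∑< L h) (+-comm 2 K)) (∑<-vanishing-tail K 2 h (λ t K≤t →
      trans (cong (suc t *_) (binomialPair-vanishˡ m n (3 + t) (s≤s (s≤s (m≤n⇒m≤1+n (≤-trans (m≤m+n m′ n′) K≤t))))))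
            (*-zeroʳ (suc t))))

  S4-cleared : ∀ m′ n′ → let m = suc m′; n = suc n′; N = m + n; A = N C m in
    2 * N * (S4 m n + (2 * m + 2 * n) C (2 * n)) ≡ 2 * N * (A * A + (N C m′) * (N C n′)) + m * n * (A * A)
  S4-cleared m′ n′ = begin
    2 * N * (S4 m n + (2 * m + 2 * n) C (2 * n))
      ≡⟨ cong₂ (λ x y → 2 * N * (x + y)) (S4≡weightedTail m n) central ⟩
    2 * N * (weightedTail m n + (P₀ + T + T))
      ≡⟨ solve 4 (λ N W P T → con 2 :* N :* (W :+ (P :+ T :+ T)) := con 2 :* N :* (W :+ con 2 :* T :+ P)) refl N (weightedTail m n) P₀ T ⟩
    2 * N * (weightedTail m n + 2 * T + P₀)
      ≡⟨ cong (λ x → 2 * N * (x + P₀)) (weightedTail-shift m′ n′) ⟩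
    2 * N * (firstMoment m n + P₁ + P₀)
      ≡⟨ solve 4 (λ N F P₁ P₀ → con 2 :* N :* (F :+ P₁ :+ P₀) := N :* (con 2 :* F) :+ con 2 :* N :* (P₀ :+ P₁))
               refl N (firstMoment m n) P₁ P₀ ⟩
    N * (2 * firstMoment m n) + 2 * N * (P₀ + P₁)
      ≡⟨ cong (λ x → N * x + 2 * N * (P₀ + P₁)) (firstMoment-closed m′ n) ⟩
    N * (N * predPair m′ n 0) + 2 * N * (P₀ + P₁)
      ≡⟨ cong₂ (λ x y → x + 2 * N * y) (predPair-scaled m′ n′) (cong₂ _+_ P₀≡ P₁≡) ⟩
    m * n * (A * A) + 2 * N * (A * A + N choose m′ * N choose n′)
      ≡⟨ +-comm (m * n * (A * A)) _ ⟩
    2 * N * (A * A + N choose m′ * N choose n′) + m * n * (A * A)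
      ≡⟨ cong₂ (λ a b → 2 * N * (a * a + b) + m * n * (a * a)) (choose≡C N m) (cong₂ _*_ (choose≡C N m′) (choose≡C N n′)) ⟩
    2 * N * ((N C m) * (N C m) + (N C m′) * (N C n′)) + m * n * ((N C m) * (N C m)) ∎
    where
    m n N A P₀ P₁ T : ℕ
    m = suc m′
    n = suc n′
    N = m + n
    A = N choose m
    P₀ = binomialPair m n 0
    P₁ = binomialPair m n 1
    T = tailSum m n
    central : (2 * m + 2 * n) C (2 * n) ≡ P₀ + T + T
    central = begin
      (2 * m + 2 * n) C (2 * n)          ≡⟨ choose≡C (2 * m + 2 * n) (2 * n) ⟨
      (2 * m + 2 * n) choose (2 * n)     ≡⟨ choose-complement (2 * m) (2 * n) refl ⟨
      (2 * m + 2 * n) choose (2 * m)     ≡⟨ cong₂ _choose_ (solve 2 (λ m n → con 2 :* m :+ con 2 :* n := m :+ n :+ (m :+ n)) refl m n)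
                                                           (solve 1 (λ m → con 2 :* m := m :+ m) refl m) ⟩
      (N + N) choose (m + m)             ≡⟨ central-vandermonde m n ⟩
      P₀ + T + T                         ∎
    P₀≡ : P₀ ≡ A * A
    P₀≡ = cong₂ _*_ (cong (N choose_) (+-identityʳ m))
                    (trans (cong (N choose_) (+-identityʳ n)) (choose-complement n m (+-comm n m)))
    P₁≡ : P₁ ≡ N choose m′ * N choose n′
    P₁≡ = trans (cong₂ _*_
      (choose-complement (m + 1) n′ (solve 2 (λ m′ n′ → con 1 :+ m′ :+ con 1 :+ n′ := con 1 :+ m′ :+ (con 1 :+ n′)) refl m′ n′))
      (choose-complement (n + 1) m′ (solve 2 (λ m′ n′ → con 1 :+ n′ :+ con 1 :+ m′ := con 1 :+ m′ :+ (con 1 :+ n′)) refl m′ n′)))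
      (*-comm (N choose n′) (N choose m′))

-- Passing to ℚ

open import Data.Nat using (ℕ; suc; NonZero)
import Data.Nat as ℕ
import Data.Nat.Properties as ℕ
open import Data.Nat.Combinatorics using (_C_)
open import Data.Integer using (+_)
import Data.Integer as ℤ
import Data.Integer.Properties as ℤ
open import Data.Rational using (ℚ; _+_; _*_; _-_; _/_; 1ℚ; toℚᵘ)
open import Data.Rational.Properties using (toℚᵘ-injective; toℚᵘ-fromℚᵘ; toℚᵘ-homo-+; toℚᵘ-homo-*; *-assoc)
import Data.Rational.Unnormalised as ℚᵘ
import Data.Rational.Unnormalised.Properties as ℚᵘ
open import Data.Rational.Solver using (module +-*-Solver)
open import Relation.Binary.PropositionalEquality
open Combinatorial using (S4-cleared)

fromℕ : ℕ → ℚ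
fromℕ k = + k / 1

toℚᵘ-fromℕ : ∀ k → toℚᵘ (fromℕ k) ℚᵘ.≃ ℚᵘ.mkℚᵘ (+ k) 0
toℚᵘ-fromℕ k = toℚᵘ-fromℚᵘ (ℚᵘ.mkℚᵘ (+ k) 0)

fromℕ-+ : ∀ a b → fromℕ (a ℕ.+ b) ≡ fromℕ a + fromℕ b
fromℕ-+ a b = toℚᵘ-injective (begin
  toℚᵘ (fromℕ (a ℕ.+ b))                         ≈⟨ toℚᵘ-fromℕ (a ℕ.+ b) ⟩
  ℚᵘ.mkℚᵘ (+ (a ℕ.+ b)) 0                        ≈⟨ ℚᵘ.*≡* (cong (ℤ._* + 1) (trans (ℤ.pos-+ a b)
                                                      (sym (cong₂ ℤ._+_ (ℤ.*-identityʳ (+ a)) (ℤ.*-identityʳ (+ b)))))) ⟩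
  ℚᵘ.mkℚᵘ (+ a) 0 ℚᵘ.+ ℚᵘ.mkℚᵘ (+ b) 0           ≈⟨ ℚᵘ.+-cong (toℚᵘ-fromℕ a) (toℚᵘ-fromℕ b) ⟨
  toℚᵘ (fromℕ a) ℚᵘ.+ toℚᵘ (fromℕ b)             ≈⟨ toℚᵘ-homo-+ (fromℕ a) (fromℕ b) ⟨
  toℚᵘ (fromℕ a + fromℕ b)                       ∎)
  where open ℚᵘ.≃-Reasoning

fromℕ-* : ∀ a b → fromℕ (a ℕ.* b) ≡ fromℕ a * fromℕ b
fromℕ-* a b = toℚᵘ-injective (begin
  toℚᵘ (fromℕ (a ℕ.* b))                         ≈⟨ toℚᵘ-fromℕ (a ℕ.* b) ⟩
  ℚᵘ.mkℚᵘ (+ (a ℕ.* b)) 0                        ≈⟨ ℚᵘ.*≡* (cong (ℤ._* + 1) (ℤ.pos-* a b)) ⟩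
  ℚᵘ.mkℚᵘ (+ a) 0 ℚᵘ.* ℚᵘ.mkℚᵘ (+ b) 0           ≈⟨ ℚᵘ.*-cong (toℚᵘ-fromℕ a) (toℚᵘ-fromℕ b) ⟨
  toℚᵘ (fromℕ a) ℚᵘ.* toℚᵘ (fromℕ b)             ≈⟨ toℚᵘ-homo-* (fromℕ a) (fromℕ b) ⟨
  toℚᵘ (fromℕ a * fromℕ b)                       ∎)
  where open ℚᵘ.≃-Reasoning

/-*-denominator : ∀ M k → (+ M / suc k) * fromℕ (suc k) ≡ fromℕ M
/-*-denominator M k = toℚᵘ-injective (begin
  toℚᵘ (+ M / suc k * fromℕ (suc k))
    ≈⟨ toℚᵘ-homo-* (+ M / suc k) (fromℕ (suc k)) ⟩
  toℚᵘ (+ M / suc k) ℚᵘ.* toℚᵘ (fromℕ (suc k))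
    ≈⟨ ℚᵘ.*-cong (toℚᵘ-fromℚᵘ (ℚᵘ.mkℚᵘ (+ M) k)) (toℚᵘ-fromℕ (suc k)) ⟩
  ℚᵘ.mkℚᵘ (+ M) k ℚᵘ.* ℚᵘ.mkℚᵘ (+ suc k) 0
    ≈⟨ ℚᵘ.*≡* (trans (ℤ.*-identityʳ _) (cong (λ n → + M ℤ.* + n) (sym (ℕ.*-identityʳ (suc k))))) ⟩
  ℚᵘ.mkℚᵘ (+ M) 0
    ≈⟨ toℚᵘ-fromℕ M ⟨
  toℚᵘ (fromℕ M) ∎)
  where open ℚᵘ.≃-Reasoning

clear-denominator : ∀ S D A X Y M K .{{_ : NonZero K}} →
  K ℕ.* (S ℕ.+ D) ≡ K ℕ.* (A ℕ.* A ℕ.+ X ℕ.* Y) ℕ.+ M ℕ.* (A ℕ.* A) →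
  fromℕ S ≡ fromℕ A * fromℕ A + fromℕ X * fromℕ Y + (+ M / K) * fromℕ A * fromℕ A - fromℕ D
clear-denominator S D A X Y M K@(suc k) cleared = begin
  s                                          ≡⟨ solve 2 (λ s d → s := con 1ℚ :* (s :+ d) :- d) refl s d ⟩
  1ℚ * (s + d) - d                           ≡⟨ cong (λ z → z * (s + d) - d) ικ≡1 ⟨
  ι * κ * (s + d) - d                        ≡⟨ cong (_- d) (*-assoc ι κ (s + d)) ⟩
  ι * (κ * (s + d)) - d                      ≡⟨ cong (λ z → ι * z - d) cleared-in-ℚ ⟩
  ι * (κ * (a * a + x * y) + μ * (a * a)) - d
    ≡⟨ cong (λ z → ι * (κ * (a * a + x * y) + z * (a * a)) - d) (/-*-denominator M k) ⟨
  ι * (κ * (a * a + x * y) + r * κ * (a * a)) - d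
    ≡⟨ solve 7 (λ ι κ a x y r d → ι :* (κ :* (a :* a :+ x :* y) :+ r :* κ :* (a :* a)) :- d
                               := ι :* κ :* (a :* a :+ x :* y) :+ r :* (ι :* κ) :* a :* a :- d) refl ι κ a x y r d ⟩
  ι * κ * (a * a + x * y) + r * (ι * κ) * a * a - d
    ≡⟨ cong (λ z → z * (a * a + x * y) + r * z * a * a - d) ικ≡1 ⟩
  1ℚ * (a * a + x * y) + r * 1ℚ * a * a - d
    ≡⟨ solve 5 (λ a x y r d → con 1ℚ :* (a :* a :+ x :* y) :+ r :* con 1ℚ :* a :* a :- d
                           := a :* a :+ x :* y :+ r :* a :* a :- d) refl a x y r d ⟩
  a * a + x * y + r * a * a - d ∎
  where
  open ≡-Reasoning
  open +-*-Solver
  s d a x y μ κ ι r : ℚ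
  s = fromℕ S
  d = fromℕ D
  a = fromℕ A
  x = fromℕ X
  y = fromℕ Y
  μ = fromℕ M
  κ = fromℕ K
  ι = + 1 / K
  r = + M / K
  ικ≡1 : ι * κ ≡ 1ℚ
  ικ≡1 = /-*-denominator 1 k
  cleared-in-ℚ : κ * (s + d) ≡ κ * (a * a + x * y) + μ * (a * a)
  cleared-in-ℚ = begin
    κ * (s + d)                                 ≡⟨ trans (fromℕ-* K (S ℕ.+ D)) (cong (κ *_) (fromℕ-+ S D)) ⟨
    fromℕ (K ℕ.* (S ℕ.+ D))                     ≡⟨ cong fromℕ cleared ⟩
    fromℕ (K ℕ.* (A ℕ.* A ℕ.+ X ℕ.* Y) ℕ.+ M ℕ.* (A ℕ.* A))
      ≡⟨ fromℕ-+ (K ℕ.* (A ℕ.* A ℕ.+ X ℕ.* Y)) (M ℕ.* (A ℕ.* A)) ⟩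
    fromℕ (K ℕ.* (A ℕ.* A ℕ.+ X ℕ.* Y)) + fromℕ (M ℕ.* (A ℕ.* A))
      ≡⟨ cong₂ _+_ (fromℕ-* K (A ℕ.* A ℕ.+ X ℕ.* Y)) (fromℕ-* M (A ℕ.* A)) ⟩
    κ * fromℕ (A ℕ.* A ℕ.+ X ℕ.* Y) + μ * fromℕ (A ℕ.* A)
      ≡⟨ cong₂ (λ u v → κ * u + μ * v)
               (trans (fromℕ-+ (A ℕ.* A) (X ℕ.* Y)) (cong₂ _+_ (fromℕ-* A A) (fromℕ-* X Y))) (fromℕ-* A A) ⟩
    κ * (a * a + x * y) + μ * (a * a)           ∎

mainTheorem2 : (m n : ℕ) → .{{_ : NonZero m}} → .{{_ : NonZero n}} →
    let N = m Data.Nat.+ n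
        q : ℕ → ℚ
        q k = (+ k) / 1
    in q (S4 m n) ≡
         q (N C m) * q (N C m)
         + q (N C (m Data.Nat.∸ 1)) * q (N C (n Data.Nat.∸ 1))
         + (_/_ (+ (m Data.Nat.* n)) (2 Data.Nat.* N) {{2[m+n]≢0 m n}}) * q (N C m) * q (N C m)
         - q ((2 Data.Nat.* m Data.Nat.+ 2 Data.Nat.* n) C (2 Data.Nat.* n))
mainTheorem2 m@(suc m′) n@(suc n′) =
  clear-denominator (S4 m n) ((2 ℕ.* m ℕ.+ 2 ℕ.* n) C (2 ℕ.* n)) (N C m) (N C m′) (N C n′) (m ℕ.* n) (2 ℕ.* N)
    {{2[m+n]≢0 m n}} (S4-cleared m′ n′)
  where
  N : ℕ
  N = m ℕ.+ n
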